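{- Let $\pi=\pi_1\cdots\pi_n$ be a Cayley permutation and suppose the value $\pi_1$ occurs exactly $k+1$ times in $\pi$, for some $k\ge 0$; denote these occurrences, from left to right, by $\pi_1,\pi_1^{(1)},\dots,\pi_1^{(k)}$, and write $\pi=\pi_1B_1\pi_1^{(1)}B_2\cdots\pi_1^{(k)}B_{k+1}$, where the (possibly empty) factors $B_1,\dots,B_{k+1}$ do not contain the value $\pi_1$. Then $$\mathcal{S}^{11}(\pi)=\mathcal{S}^{11}(B_1)\,\pi_1\,\mathcal{S}^{11}(B_2)\,\pi_1^{(1)}\cdots\mathcal{S}^{11}(B_{k+1})\,\pi_1^{(k)}.$$
   Context: A Cayley permutation is a finite word $\pi=\pi_1\cdots\pi_n$ over the positive integers such that every integer from $1$ to $\max(\pi)$ occurs at least once. A $11$-stack processes an input word (any finite word over the positive integers) from left to right with the following right-greedy algorithm: while the input is nonempty, if pushing the next input element onto the stack yields stack contents which contain no two equal letters (i.e. avoid the pattern $11$), the element is pushed; otherwise the top element of the stack is popped and appended to the output. When the input is exhausted, the remaining elements are popped one by one. $\mathcal{S}^{11}(w)$ denotes the output on input $w$ (and $\mathcal{S}^{11}$ of the empty word is empty). -}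

module Defs where

open import Data.Nat using (ℕ; zero; suc; _≤_; _≟_)
open import Data.List using (List; []; _∷_; _++_; [_]; concatMap)
open import Data.List.Membership.Propositional using (_∈_)
open import Data.List.Membership.DecPropositional _≟_ using (_∈?_)
open import Data.Product using (_×_; _,_)
open import Relation.Nullary using (yes; no)

-- A Cayley permutation: every entry is a positive integer, and every
-- integer j with 1 ≤ j ≤ max(π) occurs in π (equivalently: for every entry
-- x of π, every j with 1 ≤ j ≤ x occurs in π).
IsCayley : List ℕ → Set
IsCayley π = (∀ {x} → x ∈ π → 1 ≤ x)
           × (∀ {x j} → x ∈ π → 1 ≤ j → j ≤ x → j ∈ π)

-- Stacks are lists whose head is the top of the stack.  The stack contents
-- always avoid 11 (no repeated letter), so pushing x onto s avoids 11 iff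
-- x ∉ s.
--
-- Output is accumulated in reverse order in 'out'.
pushWith : ℕ → List ℕ → List ℕ → List ℕ × List ℕ
pushWith x [] out = out , x ∷ []
pushWith x (t ∷ s) out with x ∈? (t ∷ s)
... | no  _ = out , x ∷ t ∷ s
... | yes _ = pushWith x s (t ∷ out)

run : List ℕ → List ℕ → List ℕ → List ℕ
run []      stack revOut = Data.List.reverse revOut ++ stack
run (x ∷ w) stack revOut with pushWith x stack revOut
... | revOut' , stack' = run w stack' revOut'

S11 : List ℕ → List ℕ
S11 w = run w [] []

module Submission where

open import Defs
open import Data.Nat using (ℕ; _≟_)
open import Data.List using (List; []; _∷_; _++_; [_]; concatMap; reverse)
open import Data.List.Properties using (reverse-++; unfold-reverse; ++-assoc; reverse-involutive; ++-identityʳ)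
open import Data.List.Membership.Propositional using (_∉_)
open import Data.List.Membership.Propositional.Properties using (∈-++⁻; ∈-++⁺ˡ; ∈-++⁺ʳ)
open import Data.List.Membership.DecPropositional _≟_ using (_∈?_)
open import Data.List.Relation.Binary.Subset.Propositional using (_⊆_)
open import Data.List.Relation.Binary.Disjoint.Propositional using (Disjoint)
open import Data.List.Relation.Unary.All using (All; []; _∷_)
open import Data.List.Relation.Unary.Any using (here; there)
open import Data.Product using (_×_; _,_; proj₁; proj₂)
open import Data.Sum using (inj₁; inj₂)
open import Data.Empty using (⊥-elim)
open import Relation.Nullary using (yes; no)
open import Function using (_∘_)
open import Relation.Binary.PropositionalEquality using (_≡_; refl; sym; cong; module ≡-Reasoning)

-- Idea: after reading π₁ = a, the stack is [a].  While a block Bᵢ (which avoids a)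
-- is read, a sits at the bottom untouched and Bᵢ is processed exactly as on an
-- empty stack.  The next occurrence of a can only be pushed once the whole stack,
-- a included, has been popped; this outputs S¹¹(Bᵢ) followed by a and leaves [a].

State : Set
State = List ℕ × List ℕ

step : ℕ → State → State
step x (out , s) = pushWith x s out

feed : List ℕ → State → State
feed []      st = st
feed (x ∷ w) st = feed w (step x st)

finish : State → List ℕ
finish (out , s) = reverse out ++ s

-- Extra stack b below, and (the output being stored reversed) extra output out′ before.
under : List ℕ → List ℕ → State → State
under out′ b (out , s) = (out ++ out′ , s ++ b)

run-feed : ∀ w s out → run w s out ≡ finish (feed w (out , s))
run-feed []      s out = refl
run-feed (x ∷ w) s out with pushWith x s out
... | out′ , s′ = run-feed w s′ out′

feed-++ : ∀ w v st → feed (w ++ v) st ≡ feed v (feed w st)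
feed-++ []      v st = refl
feed-++ (x ∷ w) v st = feed-++ w v (step x st)

pushWith-fresh : ∀ {x s} → x ∉ s → ∀ out → pushWith x s out ≡ (out , x ∷ s)
pushWith-fresh {s = []}    x∉s out = refl
pushWith-fresh {x} {t ∷ s} x∉s out with x ∈? (t ∷ s)
... | yes x∈s = ⊥-elim (x∉s x∈s)
... | no  _   = refl

pushWith-stack-⊆ : ∀ x s out → proj₂ (pushWith x s out) ⊆ x ∷ s
pushWith-stack-⊆ x []      out y∈ = y∈
pushWith-stack-⊆ x (t ∷ s) out y∈ with x ∈? (t ∷ s)
... | no  _ = y∈
... | yes _ with pushWith-stack-⊆ x s (t ∷ out) y∈
...   | here y≡x = here y≡x
...   | there y∈s = there (there y∈s)

feed-stack-⊆ : ∀ w st → proj₂ (feed w st) ⊆ w ++ proj₂ st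
feed-stack-⊆ []      st y∈ = y∈
feed-stack-⊆ (x ∷ w) st y∈ with ∈-++⁻ w (feed-stack-⊆ w (step x st) y∈)
... | inj₁ y∈w = there (∈-++⁺ˡ y∈w)
... | inj₂ y∈s with pushWith-stack-⊆ x (proj₂ st) (proj₁ st) y∈s
...   | here y≡x  = here y≡x
...   | there y∈s′ = there (∈-++⁺ʳ w y∈s′)

pushWith-under : ∀ {x b} → x ∉ b → ∀ s out out′ →
  pushWith x (s ++ b) (out ++ out′) ≡ under out′ b (pushWith x s out)
pushWith-under x∉b []      out out′ = pushWith-fresh x∉b (out ++ out′)
pushWith-under {x} {b} x∉b (t ∷ s) out out′ with x ∈? (t ∷ s ++ b) | x ∈? (t ∷ s)
... | yes _ | yes _ = pushWith-under x∉b s (t ∷ out) out′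
... | no  _ | no  _ = refl
... | no x∉ | yes x∈ = ⊥-elim (x∉ (∈-++⁺ˡ x∈))
... | yes x∈ | no x∉ with ∈-++⁻ (t ∷ s) x∈
...   | inj₁ x∈s = ⊥-elim (x∉ x∈s)
...   | inj₂ x∈b = ⊥-elim (x∉b x∈b)

feed-under : ∀ {w b} → Disjoint w b → ∀ out′ st → feed w (under out′ b st) ≡ under out′ b (feed w st)
feed-under {[]}    w#b out′ st = refl
feed-under {x ∷ w} w#b out′ (out , s)
  rewrite pushWith-under (λ x∈b → w#b (here refl , x∈b)) s out out′
  = feed-under (λ (y∈w , y∈b) → w#b (there y∈w , y∈b)) out′ (pushWith x s out)

pushWith-popsThrough : ∀ {x s} → x ∉ s → ∀ b out →
  pushWith x (s ++ x ∷ b) out ≡ pushWith x b (x ∷ reverse s ++ out)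
pushWith-popsThrough {x} {[]} x∉s b out with x ∈? (x ∷ b)
... | yes _  = refl
... | no x∉ = ⊥-elim (x∉ (here refl))
pushWith-popsThrough {x} {t ∷ s} x∉s b out with x ∈? (t ∷ s ++ x ∷ b)
... | no x∉ = ⊥-elim (x∉ (∈-++⁺ʳ (t ∷ s) (here refl)))
... | yes _ rewrite pushWith-popsThrough (λ x∈s → x∉s (there x∈s)) b (t ∷ out)
                  | unfold-reverse t s | ++-assoc (reverse s) [ t ] out = refl

reverse-reverse-++ : ∀ {A : Set} (xs ys : List A) → reverse (reverse xs ++ ys) ≡ reverse ys ++ xs
reverse-reverse-++ xs ys = begin
  reverse (reverse xs ++ ys)           ≡⟨ reverse-++ (reverse xs) ys ⟩
  reverse ys ++ reverse (reverse xs)   ≡⟨ cong (reverse ys ++_) (reverse-involutive xs) ⟩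
  reverse ys ++ xs                     ∎
  where open ≡-Reasoning

step-flush : ∀ {x} st → x ∉ proj₂ st → ∀ out′ →
  step x (under out′ [ x ] st) ≡ (x ∷ reverse (finish st) ++ out′ , [ x ])
step-flush {x} (out , s) x∉s out′
  rewrite pushWith-popsThrough x∉s [] (out ++ out′) | reverse-reverse-++ out s
        | ++-assoc (reverse s) out out′ = refl

S11-feed : ∀ w → S11 w ≡ finish (feed w ([] , []))
S11-feed w = run-feed w [] []

finish-under : ∀ out′ b st → finish (under out′ b st) ≡ reverse out′ ++ finish st ++ b
finish-under out′ b (out , s) = begin
  reverse (out ++ out′) ++ s ++ b          ≡⟨ cong (_++ s ++ b) (reverse-++ out out′) ⟩
  (reverse out′ ++ reverse out) ++ s ++ b  ≡⟨ ++-assoc (reverse out′) (reverse out) (s ++ b) ⟩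
  reverse out′ ++ reverse out ++ s ++ b    ≡⟨ cong (reverse out′ ++_) (sym (++-assoc (reverse out) s b)) ⟩
  reverse out′ ++ (reverse out ++ s) ++ b  ∎
  where open ≡-Reasoning

module _ (a : ℕ) where

  blocks : List (List ℕ) → List ℕ
  blocks Bs = concatMap (λ B → a ∷ B) Bs

  sortedBlocks : List (List ℕ) → List ℕ
  sortedBlocks Bs = concatMap (λ B → S11 B ++ [ a ]) Bs

  feed-above : ∀ {B} → a ∉ B → ∀ out → feed B (out , [ a ]) ≡ under out [ a ] (feed B ([] , []))
  feed-above {B} a∉B out = feed-under {B} (λ { (a∈B , here refl) → a∉B a∈B }) out ([] , [])

  finish-block : ∀ {B} → a ∉ B → ∀ out → finish (feed B (out , [ a ])) ≡ reverse out ++ S11 B ++ [ a ]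
  finish-block {B} a∉B out = begin
    finish (feed B (out , [ a ]))       ≡⟨ cong finish (feed-above a∉B out) ⟩
    finish (under out [ a ] stB)        ≡⟨ finish-under out [ a ] stB ⟩
    reverse out ++ finish stB ++ [ a ]  ≡⟨ cong (λ o → reverse out ++ o ++ [ a ]) (sym (S11-feed B)) ⟩
    reverse out ++ S11 B ++ [ a ]       ∎
    where
    open ≡-Reasoning
    stB = feed B ([] , [])

  step-block : ∀ {B} → a ∉ B → ∀ out → step a (feed B (out , [ a ])) ≡ (reverse (S11 B ++ [ a ]) ++ out , [ a ])
  step-block {B} a∉B out = begin
    step a (feed B (out , [ a ]))              ≡⟨ cong (step a) (feed-above a∉B out) ⟩
    step a (under out [ a ] stB)               ≡⟨ step-flush stB a∉stB out ⟩
    (a ∷ reverse (finish stB) ++ out , [ a ])  ≡⟨ cong (λ o → (a ∷ reverse o ++ out , [ a ])) (sym (S11-feed B)) ⟩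
    (a ∷ reverse (S11 B) ++ out , [ a ])       ≡⟨ cong (λ r → (r ++ out , [ a ])) (sym (reverse-++ (S11 B) [ a ])) ⟩
    (reverse (S11 B ++ [ a ]) ++ out , [ a ])  ∎
    where
    open ≡-Reasoning
    stB = feed B ([] , [])
    a∉stB : a ∉ proj₂ stB
    a∉stB a∈stB with ∈-++⁻ B (feed-stack-⊆ B ([] , []) a∈stB)
    ... | inj₁ a∈B = a∉B a∈B

  run-blocks : ∀ B Bs → All (λ B → a ∉ B) (B ∷ Bs) → ∀ out →
    run (B ++ blocks Bs) [ a ] out ≡ reverse out ++ sortedBlocks (B ∷ Bs)
  run-blocks B [] (a∉B ∷ []) out = begin
    run (B ++ []) [ a ] out                ≡⟨ cong (λ w → run w [ a ] out) (++-identityʳ B) ⟩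
    run B [ a ] out                        ≡⟨ run-feed B [ a ] out ⟩
    finish (feed B (out , [ a ]))          ≡⟨ finish-block a∉B out ⟩
    reverse out ++ S11 B ++ [ a ]          ≡⟨ cong (reverse out ++_) (sym (++-identityʳ (S11 B ++ [ a ]))) ⟩
    reverse out ++ (S11 B ++ [ a ]) ++ []  ∎
    where open ≡-Reasoning
  run-blocks B (B′ ∷ Bs) (a∉B ∷ a∉Bs) out = begin
    run (B ++ a ∷ rest) [ a ] out                    ≡⟨ run-feed (B ++ a ∷ rest) [ a ] out ⟩
    finish (feed (B ++ a ∷ rest) (out , [ a ]))      ≡⟨ cong finish (feed-++ B (a ∷ rest) (out , [ a ])) ⟩
    finish (feed rest (step a (feed B (out , [ a ])))) ≡⟨ cong (finish ∘ feed rest) (step-block a∉B out) ⟩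
    finish (feed rest (out″ , [ a ]))                ≡⟨ sym (run-feed rest [ a ] out″) ⟩
    run rest [ a ] out″                              ≡⟨ run-blocks B′ Bs a∉Bs out″ ⟩
    reverse out″ ++ sorted                           ≡⟨ cong (_++ sorted) (reverse-reverse-++ (S11 B ++ [ a ]) out) ⟩
    (reverse out ++ S11 B ++ [ a ]) ++ sorted        ≡⟨ ++-assoc (reverse out) (S11 B ++ [ a ]) sorted ⟩
    reverse out ++ (S11 B ++ [ a ]) ++ sorted        ∎
    where
    open ≡-Reasoning
    rest = B′ ++ blocks Bs
    sorted = sortedBlocks (B′ ∷ Bs)
    out″ = reverse (S11 B ++ [ a ]) ++ out

lemma2 : (π : List ℕ) → IsCayley π →
    (a : ℕ) (B₁ : List ℕ) (Bs : List (List ℕ)) →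
    All (λ B → a ∉ B) (B₁ ∷ Bs) →
    π ≡ a ∷ B₁ ++ concatMap (λ B → a ∷ B) Bs →
    S11 π ≡ concatMap (λ B → S11 B ++ [ a ]) (B₁ ∷ Bs)
lemma2 π _ a B₁ Bs a∉blocks refl = run-blocks a B₁ Bs a∉blocks []
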